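{- Let $P$ be a program and let $B$ be a set of pattern rules that is correct w.r.t. $P$. Suppose that $\mathit{patunf}(P,B)$ contains a pattern rule of the form $((u,(\sigma,\mu)),(u\sigma^a,(\sigma^b\sigma',\mu\mu')))$, where $a,b\in\mathbb N$, $u\in T(\Sigma,X)$, $\sigma,\mu,\sigma',\mu'\in S(\Sigma,X)$ and $\sigma'$ commutes with $\sigma$ and with $\mu$. Then for all $n\in\mathbb N$ and all $\theta\in S(\Sigma,X)$ there is an infinite $\Rightarrow_P$-chain that starts from $\langle u\sigma^n\mu\theta\rangle$.
   Context: Fix a signature $\Sigma$, a special constant $\mathsf{e}$ (also denoting the empty sequence) and an infinite countable set $X$ of variables, pairwise disjoint. $T(\Sigma,X)$ is the set of terms, $S(\Sigma,X)$ the set of substitutions (maps $X\to T(\Sigma,X)$ moving finitely many variables); composition $x(\sigma\theta)=(x\sigma)\theta$; $\emptyset$ is the identity substitution, $\sigma^0=\emptyset$, $\sigma^{n+1}=\sigma^n\sigma$; $\mathsf{e}\theta=\mathsf{e}$. $\sigma$ commutes with $\theta$ if $x\sigma\theta=x\theta\sigma$ for all $x\in X$. A renaming is a substitution that is a bijection on $X$; $\mathit{mgu}$ is the set of most general unifiers (componentwise on finite sequences). $\mathit{Var}(\sigma)$ is the set of variables in the domain or in the images of the domain. A program is a set of rules $(u,\bar v)$ ($u$ a term, $\bar v$ a finite sequence of terms written $\langle\dots\rangle$, juxtaposition being concatenation); binary rules have $\bar v$ of length $\le1$, written $(u,v)$ with $v\in T(\Sigma,X)\cup\{\mathsf{e}\}$.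 $[r]$ is the set of renamings of a rule $r$, $[U]=\bigcup_{r\in U}[r]$; $\bar r\ll_S U$ means $\bar r$ is a sequence of elements of $U$ variable disjoint from $S$ and from each other. For a rule $r$, $\Rightarrow_r=\{(\langle s\rangle\bar s,(\bar v\,\bar s)\theta)\mid\langle(u,\bar v)\rangle\ll_{\langle s\rangle\bar s}[r],\ \theta\in\mathit{mgu}(u,s)\}$ and $\Rightarrow_P=\bigcup_{r\in P}\Rightarrow_r$; a $\Rightarrow_P$-chain is a sequence of finite term sequences with consecutive elements related by $\Rightarrow_P$. Let $\mathit{id}$ be the set of rules $(\mathsf{f}(x_1,\dots,x_m),\mathsf{f}(x_1,\dots,x_m))$, $\mathsf{f}\in\Sigma$ of arity $m$, $x_i$ distinct variables. For a set $U$ of binary rules, $T_P^\beta(U)=[\{(u,\mathsf{e})\in P\}]\cup[\{(u\theta,v\theta)\mid r=(u,\langle v_1,\dots,v_m\rangle)\in P,\ 1\le i\le m,\ \langle(u_1,\mathsf{e}),\dots,(u_{i-1},\mathsf{e}),(u_i,v)\rangle\ll_r U\cup\mathit{id},\ v\neq\mathsf{e}\text{ if }i<m,\ \theta\in\mathit{mgu}(\langle u_1,\dots,u_i\rangle,\langle v_1,\dots,v_i\rangle)\}]$; $\mathit{binunf}(P)=\bigcup_{n\in\mathbb N}(T_P^\beta)^n(\emptyset)$. A pattern substitution is a pair $(\sigma,\mu)$ of substitutions, with $(\sigma,\mu)(n)=\sigma^n\mu$. A pattern term is $p=(s,(\sigma,\mu))$ with $s\in T(\Sigma,X)\cup\{\mathsf{e}\}$,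 $p(n)=s\sigma^n\mu$, $\mathit{Var}(p)=\mathit{Var}(s)\cup\mathit{Var}(\sigma)\cup\mathit{Var}(\mu)$; $\widehat{s}=(s,(\emptyset,\emptyset))$. A pattern rule is a pair $r=(p,q)$ of pattern terms, $\mathit{Var}(r)=\mathit{Var}(p)\cup\mathit{Var}(q)$, $\mathit{rules}(r)=\{(p(n),q(n))\mid n\in\mathbb N\}$; it is correct w.r.t. $P$ if $\mathit{rules}(r)\subseteq\mathit{binunf}(P)$, and a set of pattern rules is correct if all its elements are. A pattern substitution $\theta$ is an mgu of two equal-length sequences of pattern terms if for every $n$, $\theta(n)$ is an mgu of the corresponding sequences of $n$-th instances. For a pattern rule $r$, $[r]=\{r'\mid\mathit{rules}(r')\subseteq[\mathit{rules}(r)]\}$, $[U]=\bigcup_{r\in U}[r]$; $\ll_r$ is extended to pattern rules via the variable sets above. $\mathit{patid}$ is the set of pattern rules $(\widehat{\mathsf{f}(x_1,\dots,x_m)},\widehat{\mathsf{f}(x_1,\dots,x_m)})$. For sets $B,U$ of pattern rules, $T^\pi_{P,B}(U)=[B]\cup[\{((u,(\sigma,\mu)),(v,(\sigma_i\sigma,\mu_i\mu)))\mid r=(u,\langle v_1,\dots,v_m\rangle)\in P,\ 1\le i\le m,\ \langle(p_1,\widehat{\mathsf{e}}),\dots,(p_{i-1},\widehat{\mathsf{e}}),(p_i,(v,(\sigma_i,\mu_i)))\rangle\ll_r U\cup\mathit{patid},\ v\neq\mathsf{e}\text{ if }i<m,\ (\sigma,\mu)\text{ an mgu of }\langle p_1,\dots,p_i\rangle\text{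 and }\langle\widehat{v_1},\dots,\widehat{v_i}\rangle,\ \sigma\text{ commutes with }\sigma_i\text{ and }\mu_i\}]$, and $\mathit{patunf}(P,B)=\bigcup_{n\in\mathbb N}(T^\pi_{P,B})^n(\emptyset)$. -}

module Defs where

open import Data.Nat using (ℕ; zero; suc; _≤_; _<_; _⊔_)
open import Data.Nat.Properties using (≤-trans; m≤m⊔n; m≤n⊔m)
open import Data.Fin using (Fin)
open import Data.Vec using (Vec; []; _∷_; tabulate)
open import Data.List using (List; []; _∷_; _++_; map; take; length) renaming ([_] to ⟨_⟩)
open import Data.List.Membership.Propositional using (_∈_)
open import Data.List.Relation.Unary.All using (All)
open import Data.List.Relation.Unary.AllPairs using (AllPairs)
open import Data.Product using (Σ; ∃; _×_; _,_; proj₁; proj₂)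
open import Data.Sum using (_⊎_)
open import Data.Empty using (⊥)
open import Relation.Nullary using (¬_)
open import Relation.Binary.PropositionalEquality using (_≡_; _≢_; refl; trans; cong)

-- A signature Σ: function symbols with arities.  The special constant e
-- is NOT a symbol of Σ; it is modelled by the constructor ε of TermE.
-- Variables: X = ℕ (an infinite countable set).

record Signature : Set₁ where
  field
    Sym   : Set
    arity : Sym → ℕ

module Theory (Sig : Signature) where
  open Signature Sig

  data Term : Set where
    var : ℕ → Term
    fn  : (f : Sym) → Vec Term (arity f) → Term

  data TermE : Set where
    ε  : TermE
    tm : Term → TermE

  mutual
    vars : Term → List ℕ
    vars (var x)  = x ∷ []
    vars (fn f ts) = varsV ts

    varsV : ∀ {n} → Vec Term n → List ℕ
    varsV []       = []
    varsV (t ∷ ts) = vars t ++ varsV ts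

  VarT : Term → ℕ → Set
  VarT t x = x ∈ vars t

  VarE : TermE → ℕ → Set
  VarE ε      x = ⊥
  VarE (tm t) x = VarT t x

  VarL : List Term → ℕ → Set
  VarL []       x = ⊥
  VarL (t ∷ ts) x = VarT t x ⊎ VarL ts x

  mutual
    _⟦_⟧ : Term → (ℕ → Term) → Term
    var x    ⟦ s ⟧ = s x
    fn f ts  ⟦ s ⟧ = fn f (ts ⟦ s ⟧V)

    _⟦_⟧V : ∀ {n} → Vec Term n → (ℕ → Term) → Vec Term n
    []       ⟦ s ⟧V = []
    (t ∷ ts) ⟦ s ⟧V = (t ⟦ s ⟧) ∷ (ts ⟦ s ⟧V)

  -- S(Σ,X): substitutions moving finitely many variables
  -- (on X = ℕ: identity beyond some bound)
  record Subst : Set where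
    field
      app : ℕ → Term
      fin : ∃ λ N → ∀ x → N ≤ x → app x ≡ var x
  open Subst public

  _[_] : Term → Subst → Term
  t [ σ ] = t ⟦ app σ ⟧

  _[_]E : TermE → Subst → TermE
  ε    [ σ ]E = ε
  tm t [ σ ]E = tm (t [ σ ])

  ∅ : Subst
  ∅ = record { app = var ; fin = 0 , λ _ _ → refl }

  _⊙_ : Subst → Subst → Subst
  σ ⊙ θ = record
    { app = λ x → app σ x [ θ ]
    ; fin = (proj₁ (fin σ) ⊔ proj₁ (fin θ)) , λ x h →
        trans (cong (_[ θ ]) (proj₂ (fin σ) x (≤-trans (m≤m⊔n _ _) h)))
              (proj₂ (fin θ) x (≤-trans (m≤n⊔m _ _) h)) }

  pow : Subst → ℕ → Subst
  pow σ zero    = ∅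
  pow σ (suc n) = pow σ n ⊙ σ

  Commutes : Subst → Subst → Set
  Commutes σ θ = ∀ x → (app σ x [ θ ]) ≡ (app θ x [ σ ])

  VarS : Subst → ℕ → Set
  VarS σ x = (app σ x ≢ var x) ⊎ (∃ λ y → (app σ y ≢ var y) × VarT (app σ y) x)

  Disjoint : (ℕ → Set) → (ℕ → Set) → Set
  Disjoint A B = ∀ x → A x → B x → ⊥

  IsRenaming : Subst → Set
  IsRenaming ρ = ∃ λ (f : ℕ → ℕ) → (∀ x → app ρ x ≡ var (f x))
                   × (∀ x y → f x ≡ f y → x ≡ y) × (∀ y → ∃ λ x → f x ≡ y)

  Unifies : Subst → List TermE → List TermE → Set
  Unifies θ as bs = map (_[ θ ]E) as ≡ map (_[ θ ]E) bs

  MGU : Subst → List TermE → List TermE → Set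
  MGU θ as bs = Unifies θ as bs ×
    (∀ η → Unifies η as bs → ∃ λ δ → ∀ x → app η x ≡ app (θ ⊙ δ) x)

  Rule : Set
  Rule = Term × List Term

  Program : Set₁
  Program = Rule → Set

  VarR : Rule → ℕ → Set
  VarR (u , vs) x = VarT u x ⊎ VarL vs x

  RenRule : Rule → Rule → Set
  RenRule r r' = ∃ λ ρ → IsRenaming ρ ×
    (r' ≡ (proj₁ r [ ρ ] , map (_[ ρ ]) (proj₂ r)))

  Step : Rule → List Term → List Term → Set
  Step r ss ss' = ∃ λ s → ∃ λ s̄ → (ss ≡ s ∷ s̄) × ∃ λ u → ∃ λ v̄ →
    RenRule r (u , v̄) × Disjoint (VarR (u , v̄)) (VarL (s ∷ s̄)) ×
    ∃ λ θ → MGU θ ⟨ tm u ⟩ ⟨ tm s ⟩ × (ss' ≡ map (_[ θ ]) (v̄ ++ s̄))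

  StepP : Program → List Term → List Term → Set
  StepP P ss ss' = ∃ λ r → P r × Step r ss ss'

  InfiniteChainFrom : Program → List Term → Set
  InfiniteChainFrom P ss = ∃ λ (c : ℕ → List Term) →
    (c 0 ≡ ss) × (∀ k → StepP P (c k) (c (suc k)))

  -- binary rules (u , v), v ∈ T ∪ {e}; the head is a term in every
  -- binary rule actually produced (pairs of TermE are used so that
  -- rules(r) of a pattern rule is a set of such pairs)

  BinRule : Set
  BinRule = TermE × TermE

  VarB : BinRule → ℕ → Set
  VarB (a , b) x = VarE a x ⊎ VarE b x

  RenB : BinRule → BinRule → Set
  RenB b b' = ∃ λ ρ → IsRenaming ρ × (b' ≡ (proj₁ b [ ρ ]E , proj₂ b [ ρ ]E))

  RenClosB : (BinRule → Set) → BinRule → Set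
  RenClosB U b = ∃ λ b₀ → U b₀ × RenB b₀ b

  idTerm : (f : Sym) → (Fin (arity f) → ℕ) → Term
  idTerm f xs = fn f (tabulate (λ i → var (xs i)))

  IdRules : BinRule → Set
  IdRules b = ∃ λ f → ∃ λ (xs : Fin (arity f) → ℕ) →
    (∀ i j → xs i ≡ xs j → i ≡ j) × (b ≡ (tm (idTerm f xs) , tm (idTerm f xs)))

  _∪_ : {A : Set} → (A → Set) → (A → Set) → A → Set
  (U ∪ V) a = U a ⊎ V a

  ≪ : {A : Set} → (A → ℕ → Set) → List A → (ℕ → Set) → (A → Set) → Set
  ≪ VarA seq S U = All U seq × All (λ a → Disjoint (VarA a) S) seq
                   × AllPairs (λ a b → Disjoint (VarA a) (VarA b)) seq

  GenB : Program → (BinRule → Set) → BinRule → Set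
  GenB P U b = ∃ λ u → ∃ λ vs → P (u , vs) ×
    ∃ λ (us : List TermE) → ∃ λ ui → ∃ λ v →
    let i = suc (length us) in
    (i ≤ length vs) ×
    ≪ VarB (map (λ w → (w , ε)) us ++ ⟨ (ui , v) ⟩) (VarR (u , vs)) (U ∪ IdRules) ×
    (i < length vs → v ≢ ε) ×
    ∃ λ θ → MGU θ (us ++ ⟨ ui ⟩) (map tm (take i vs)) ×
    (b ≡ (tm (u [ θ ]) , v [ θ ]E))

  FactsB : Program → BinRule → Set
  FactsB P b = ∃ λ u → P (u , []) × (b ≡ (tm u , ε))

  Tβ : Program → (BinRule → Set) → BinRule → Set
  Tβ P U = RenClosB (FactsB P) ∪ RenClosB (GenB P U)

  iterβ : Program → ℕ → BinRule → Set
  iterβ P zero    b = ⊥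
  iterβ P (suc n) b = Tβ P (iterβ P n) b

  binunf : Program → BinRule → Set
  binunf P b = ∃ λ n → iterβ P n b

  PatSubst : Set
  PatSubst = Subst × Subst

  patInst : PatSubst → ℕ → Subst
  patInst (σ , μ) n = pow σ n ⊙ μ

  PatTerm : Set
  PatTerm = TermE × PatSubst

  instP : PatTerm → ℕ → TermE
  instP (s , θ) n = s [ patInst θ n ]E

  VarP : PatTerm → ℕ → Set
  VarP (s , (σ , μ)) x = VarE s x ⊎ VarS σ x ⊎ VarS μ x

  hat : TermE → PatTerm
  hat s = s , (∅ , ∅)

  PatRule : Set
  PatRule = PatTerm × PatTerm

  VarPR : PatRule → ℕ → Set
  VarPR (p , q) x = VarP p x ⊎ VarP q x

  rules : PatRule → BinRule → Set
  rules (p , q) b = ∃ λ n → b ≡ (instP p n , instP q n)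

  Correct : Program → PatRule → Set
  Correct P r = ∀ b → rules r b → binunf P b

  CorrectSet : Program → (PatRule → Set) → Set
  CorrectSet P B = ∀ r → B r → Correct P r

  PatMGU : PatSubst → List PatTerm → List PatTerm → Set
  PatMGU θ ps qs = ∀ n →
    MGU (patInst θ n) (map (λ p → instP p n) ps) (map (λ q → instP q n) qs)

  RenPat : PatRule → PatRule → Set
  RenPat r r' = ∀ b → rules r' b → RenClosB (rules r) b

  RenClosP : (PatRule → Set) → PatRule → Set
  RenClosP U r' = ∃ λ r → U r × RenPat r r'

  PatId : PatRule → Set
  PatId r = ∃ λ f → ∃ λ (xs : Fin (arity f) → ℕ) →
    (∀ i j → xs i ≡ xs j → i ≡ j) ×
    (r ≡ (hat (tm (idTerm f xs)) , hat (tm (idTerm f xs))))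

  GenP : Program → (PatRule → Set) → PatRule → Set
  GenP P U r' = ∃ λ u → ∃ λ vs → P (u , vs) ×
    ∃ λ (ps : List PatTerm) → ∃ λ pi → ∃ λ v → ∃ λ σi → ∃ λ μi →
    let i = suc (length ps) in
    (i ≤ length vs) ×
    ≪ VarPR (map (λ p → (p , hat ε)) ps ++ ⟨ (pi , (v , (σi , μi))) ⟩)
            (VarR (u , vs)) (U ∪ PatId) ×
    (i < length vs → v ≢ ε) ×
    ∃ λ σ → ∃ λ μ →
    PatMGU (σ , μ) (ps ++ ⟨ pi ⟩) (map (λ w → hat (tm w)) (take i vs)) ×
    Commutes σ σi × Commutes σ μi ×
    (r' ≡ ((tm u , (σ , μ)) , (v , (σi ⊙ σ , μi ⊙ μ))))

  Tπ : Program → (PatRule → Set) → (PatRule → Set) → PatRule → Set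
  Tπ P B U = RenClosP B ∪ RenClosP (GenP P U)

  iterπ : Program → (PatRule → Set) → ℕ → PatRule → Set
  iterπ P B zero    r = ⊥
  iterπ P B (suc n) r = Tπ P B (iterπ P B n) r

  patunf : Program → (PatRule → Set) → PatRule → Set
  patunf P B r = ∃ λ n → iterπ P B n r

-- A binary rule (h , v) of binunf P can be read operationally: in any context s̄, every instance
-- h ξ derives, by resolution steps with instances of clauses of P, the instance v ξ followed by
-- further goals (or s̄ itself when v = e).  This reading is preserved by T^β_P, and, instance by
-- instance, by T^π_{P,B}: the n-th instance of a rule produced by T^π_{P,B} is the resolvent of
-- the n-th instances of its premises, because σ commutes with σᵢ and μᵢ.  Since B is correct, every
-- instance of a rule of patunf(P,B) is realised in this way.  For the given rule, the m-th
-- instance turns u σ^m μ ξ, in at least one step, into u σ^a (σ^b σ')^m μ μ' ξ, which equals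
-- u σ^(a+mb) μ (σ'^m μ' ξ) because σ' commutes with σ and μ: an atom of the same shape.  Iterating
-- gives an infinite derivation with clause instances, and the lifting lemma (rename the clause
-- apart, then take a most general unifier, which exists as soon as the atoms are unifiable) turns
-- it into an infinite ⇒_P-chain.
module Submission where

open import Defs
open import Data.Nat using (ℕ; zero; suc; _+_; _*_; _∸_; _≤_; _<_; _⊔_; s≤s; _≟_; _<?_)
open import Data.Nat.Properties
  using ( ≤-refl; ≤-trans; ≤-totalOrder; <-irrefl; <⇒≱; ≤⇒≯; ≮⇒≥; n<1+n; m<n⇒m<1+n; m≤n⇒m≤1+n
        ; m≤m+n; m≤n+m; m≤m⊔n; m≤n⊔m; +-suc; +-identityʳ; +-comm; +-monoˡ-<; +-mono-<
        ; m+n∸n≡m; m∸n+n≡m; ∸-monoˡ-< )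
open import Data.Bool using (if_then_else_)
open import Data.Empty using (⊥; ⊥-elim)
open import Data.List using (List; []; _∷_; _++_; map; filter; concatMap; length; take; drop)
  renaming ([_] to ⟨_⟩)
import Data.List.Properties as List
open import Data.List.Properties using (filter-notAll)
open import Data.List.Extrema ≤-totalOrder using (max; xs≤max)
open import Data.List.Membership.Propositional using (_∈_; _∉_)
open import Data.List.Membership.Propositional.Properties using (∈-++⁺ˡ; ∈-++⁺ʳ; ∈-++⁻; ∈-filter⁺)
open import Data.List.Membership.DecPropositional _≟_ using (_∈?_)
open import Data.List.Relation.Binary.Pointwise using (Pointwise; []; _∷_)
open import Data.List.Relation.Binary.Subset.Propositional using (_⊆_)
open import Data.List.Relation.Unary.All using (All; []; _∷_)
import Data.List.Relation.Unary.All as All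
import Data.List.Relation.Unary.All.Properties as All
import Data.List.Relation.Unary.Any as Any
open import Data.List.Relation.Unary.Any using (here)
open import Data.Nat.Induction using (<-wellFounded)
open import Data.Nat.Tactic.RingSolver using (solve-∀)
open import Data.Product using (Σ; ∃; _×_; _,_; proj₁; proj₂)
open import Data.Sum using (inj₁; inj₂)
import Data.Vec.Properties as Vec
open import Data.Vec using (Vec; []; _∷_)
open import Function using (_∘_)
open import Induction.WellFounded using (Acc; acc)
open import Relation.Binary.Bundles using (Setoid)
open import Relation.Binary.Construct.Closure.ReflexiveTransitive using (Star; ε; _◅_; _◅◅_)
open import Relation.Binary.PropositionalEquality
  using (_≡_; _≢_; refl; sym; trans; cong; cong₂; subst; subst₂; module ≡-Reasoning)
import Relation.Binary.Reasoning.Setoid as SetoidReasoning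
open import Relation.Nullary using (yes; no; ¬_; ¬?; does)
open import Relation.Nullary.Decidable using (dec-true; dec-false)

InfiniteChain : {A : Set} → (A → A → Set) → A → Set
InfiniteChain {A} R x = Σ (ℕ → A) λ c → c 0 ≡ x × ∀ k → R (c k) (c (suc k))

infiniteChain-unfold : ∀ {A : Set} {R : A → A → Set} (I : A → Set) →
                       (∀ {x} → I x → ∃ λ y → R x y × I y) → ∀ {x} → I x → InfiniteChain R x
infiniteChain-unfold {A} I next {x} Ix = proj₁ ∘ state , refl , λ k → proj₁ (proj₂ (next (proj₂ (state k))))
  where
  state : ℕ → Σ A I
  state zero    = x , Ix
  state (suc k) = let y , _ , Iy = next (proj₂ (state k)) in y , Iy

Plus : {A : Set} → (A → A → Set) → A → A → Set
Plus R x z = ∃ λ y → R x y × Star R y z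

infiniteChain-progress : ∀ {A : Set} {R : A → A → Set} (Q : A → Set) →
                         (∀ {x} → Q x → ∃ λ y → Plus R x y × Q y) → ∀ {x} → Q x → InfiniteChain R x
infiniteChain-progress {A} {R} Q progress Qx = infiniteChain-unfold Pending next (_ , ε , Qx)
  where
  Pending : A → Set
  Pending x = ∃ λ y → Star R x y × Q y
  next : ∀ {x} → Pending x → ∃ λ y → R x y × Pending y
  next (_ , ε , Qy)        = let z , (y′ , y→y′ , y′→*z) , Qz = progress Qy in y′ , y→y′ , z , y′→*z , Qz
  next (y , x→ ◅ →*y , Qy) = _ , x→ , y , →*y , Qy

module Substitutions (Sg : Signature) where
  open Signature Sg
  open Theory Sg

  mutual
    ⟦⟧-local : ∀ t {s s′ : ℕ → Term} → (∀ y → y ∈ vars t → s y ≡ s′ y) → t ⟦ s ⟧ ≡ t ⟦ s′ ⟧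
    ⟦⟧-local (var x)   s≗s′ = s≗s′ x (here refl)
    ⟦⟧-local (fn f ts) s≗s′ = cong (fn f) (⟦⟧V-local ts s≗s′)

    ⟦⟧V-local : ∀ {n} (ts : Vec Term n) {s s′ : ℕ → Term} →
                (∀ y → y ∈ varsV ts → s y ≡ s′ y) → ts ⟦ s ⟧V ≡ ts ⟦ s′ ⟧V
    ⟦⟧V-local []       s≗s′ = refl
    ⟦⟧V-local (t ∷ ts) s≗s′ =
      cong₂ _∷_ (⟦⟧-local t (λ y y∈ → s≗s′ y (∈-++⁺ˡ y∈)))
                (⟦⟧V-local ts (λ y y∈ → s≗s′ y (∈-++⁺ʳ (vars t) y∈)))

  mutual
    ⟦⟧-∘ : ∀ t (s s′ : ℕ → Term) → t ⟦ s ⟧ ⟦ s′ ⟧ ≡ t ⟦ (λ y → s y ⟦ s′ ⟧) ⟧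
    ⟦⟧-∘ (var x)   s s′ = refl
    ⟦⟧-∘ (fn f ts) s s′ = cong (fn f) (⟦⟧V-∘ ts s s′)

    ⟦⟧V-∘ : ∀ {n} (ts : Vec Term n) (s s′ : ℕ → Term) →
            ts ⟦ s ⟧V ⟦ s′ ⟧V ≡ ts ⟦ (λ y → s y ⟦ s′ ⟧) ⟧V
    ⟦⟧V-∘ []       s s′ = refl
    ⟦⟧V-∘ (t ∷ ts) s s′ = cong₂ _∷_ (⟦⟧-∘ t s s′) (⟦⟧V-∘ ts s s′)

  mutual
    ⟦var⟧ : ∀ t → t ⟦ var ⟧ ≡ t
    ⟦var⟧ (var x)   = refl
    ⟦var⟧ (fn f ts) = cong (fn f) (⟦var⟧V ts)

    ⟦var⟧V : ∀ {n} (ts : Vec Term n) → ts ⟦ var ⟧V ≡ ts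
    ⟦var⟧V []       = refl
    ⟦var⟧V (t ∷ ts) = cong₂ _∷_ (⟦var⟧ t) (⟦var⟧V ts)

  mutual
    vars-⟦⟧ : ∀ t (s : ℕ → Term) {x} → x ∈ vars (t ⟦ s ⟧) → ∃ λ y → y ∈ vars t × x ∈ vars (s y)
    vars-⟦⟧ (var y)   s x∈ = y , here refl , x∈
    vars-⟦⟧ (fn f ts) s x∈ = varsV-⟦⟧ ts s x∈

    varsV-⟦⟧ : ∀ {n} (ts : Vec Term n) (s : ℕ → Term) {x} →
               x ∈ varsV (ts ⟦ s ⟧V) → ∃ λ y → y ∈ varsV ts × x ∈ vars (s y)
    varsV-⟦⟧ (t ∷ ts) s x∈ with ∈-++⁻ (vars (t ⟦ s ⟧)) x∈
    ... | inj₁ x∈t  = let y , y∈ , x∈y = vars-⟦⟧ t s x∈t in y , ∈-++⁺ˡ y∈ , x∈y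
    ... | inj₂ x∈ts = let y , y∈ , x∈y = varsV-⟦⟧ ts s x∈ts in y , ∈-++⁺ʳ (vars t) y∈ , x∈y

  mutual
    size : Term → ℕ
    size (var x)   = 1
    size (fn f ts) = suc (sizeV ts)

    sizeV : ∀ {n} → Vec Term n → ℕ
    sizeV []       = 0
    sizeV (t ∷ ts) = size t + sizeV ts

  mutual
    size-⟦⟧ : ∀ t (s : ℕ → Term) {y} → y ∈ vars t → size (s y) ≤ size (t ⟦ s ⟧)
    size-⟦⟧ (var x)   s (here refl) = ≤-refl
    size-⟦⟧ (fn f ts) s y∈          = m≤n⇒m≤1+n (sizeV-⟦⟧ ts s y∈)

    sizeV-⟦⟧ : ∀ {n} (ts : Vec Term n) (s : ℕ → Term) {y} → y ∈ varsV ts → size (s y) ≤ sizeV (ts ⟦ s ⟧V)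
    sizeV-⟦⟧ (t ∷ ts) s y∈ with ∈-++⁻ (vars t) y∈
    ... | inj₁ y∈t  = ≤-trans (size-⟦⟧ t s y∈t) (m≤m+n _ _)
    ... | inj₂ y∈ts = ≤-trans (sizeV-⟦⟧ ts s y∈ts) (m≤n+m _ _)

  tm-injective : ∀ {s t} → tm s ≡ tm t → s ≡ t
  tm-injective refl = refl

  []-⊙ : ∀ t σ τ → t [ σ ] [ τ ] ≡ t [ σ ⊙ τ ]
  []-⊙ t σ τ = ⟦⟧-∘ t (app σ) (app τ)

  []E-⊙ : ∀ v σ τ → v [ σ ]E [ τ ]E ≡ v [ σ ⊙ τ ]E
  []E-⊙ ε      σ τ = refl
  []E-⊙ (tm t) σ τ = cong tm ([]-⊙ t σ τ)

  []E-ε : ∀ v σ → v [ σ ]E ≡ ε → v ≡ ε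
  []E-ε ε      σ _ = refl
  []E-ε (tm t) σ ()

  infix 4 _≈_
  record _≈_ (σ τ : Subst) : Set where
    constructor mk≈
    field app-≈ : ∀ x → app σ x ≡ app τ x
  open _≈_ public

  ≈-refl : ∀ {σ} → σ ≈ σ
  ≈-refl = mk≈ λ _ → refl

  ≈-sym : ∀ {σ τ} → σ ≈ τ → τ ≈ σ
  ≈-sym σ≈τ = mk≈ λ x → sym (app-≈ σ≈τ x)

  ≈-trans : ∀ {σ τ ρ} → σ ≈ τ → τ ≈ ρ → σ ≈ ρ
  ≈-trans σ≈τ τ≈ρ = mk≈ λ x → trans (app-≈ σ≈τ x) (app-≈ τ≈ρ x)

  ≈-setoid : Setoid _ _
  ≈-setoid = record
    { Carrier = Subst ; _≈_ = _≈_
    ; isEquivalence = record { refl = ≈-refl ; sym = ≈-sym ; trans = ≈-trans } }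

  []-cong : ∀ t {σ τ} → σ ≈ τ → t [ σ ] ≡ t [ τ ]
  []-cong t σ≈τ = ⟦⟧-local t (λ y _ → app-≈ σ≈τ y)

  []E-cong : ∀ v {σ τ} → σ ≈ τ → v [ σ ]E ≡ v [ τ ]E
  []E-cong ε      σ≈τ = refl
  []E-cong (tm t) σ≈τ = cong tm ([]-cong t σ≈τ)

  []-identity : ∀ t → t [ ∅ ] ≡ t
  []-identity = ⟦var⟧

  map-[]-⊙ : ∀ σ τ ts → map (_[ τ ]) (map (_[ σ ]) ts) ≡ map (_[ σ ⊙ τ ]) ts
  map-[]-⊙ σ τ ts = trans (sym (List.map-∘ ts)) (List.map-cong (λ t → []-⊙ t σ τ) ts)

  map-[]-cong : ∀ {σ τ} → σ ≈ τ → ∀ ts → map (_[ σ ]) ts ≡ map (_[ τ ]) ts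
  map-[]-cong σ≈τ = List.map-cong (λ t → []-cong t σ≈τ)

  map-[]-identity : ∀ ts → map (_[ ∅ ]) ts ≡ ts
  map-[]-identity ts = trans (List.map-cong []-identity ts) (List.map-id ts)

  []-regroup : ∀ t σ τ σ′ τ′ ξ → σ ⊙ τ ≈ σ′ ⊙ τ′ → t [ σ ] [ τ ] [ ξ ] ≡ t [ σ′ ] [ τ′ ⊙ ξ ]
  []-regroup t σ τ σ′ τ′ ξ στ≈σ′τ′ =
    trans (cong (_[ ξ ]) (trans ([]-⊙ t σ τ) (trans ([]-cong t στ≈σ′τ′) (sym ([]-⊙ t σ′ τ′)))))
          ([]-⊙ (t [ σ′ ]) τ′ ξ)

  ⊙-assoc : ∀ σ τ ρ → (σ ⊙ τ) ⊙ ρ ≈ σ ⊙ (τ ⊙ ρ)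
  ⊙-assoc σ τ ρ = mk≈ λ x → []-⊙ (app σ x) τ ρ

  ⊙-cong : ∀ {σ σ′ τ τ′} → σ ≈ σ′ → τ ≈ τ′ → σ ⊙ τ ≈ σ′ ⊙ τ′
  ⊙-cong {σ′ = σ′} {τ} σ≈σ′ τ≈τ′ =
    mk≈ λ x → trans (cong (_[ τ ]) (app-≈ σ≈σ′ x)) ([]-cong (app σ′ x) τ≈τ′)

  ⊙-identityˡ : ∀ σ → ∅ ⊙ σ ≈ σ
  ⊙-identityˡ σ = mk≈ λ _ → refl

  ⊙-identityʳ : ∀ σ → σ ⊙ ∅ ≈ σ
  ⊙-identityʳ σ = mk≈ λ x → []-identity (app σ x)

  open SetoidReasoning ≈-setoid

  ⊙-interchange : ∀ x y z w → z ⊙ y ≈ y ⊙ z → (x ⊙ z) ⊙ (y ⊙ w) ≈ (x ⊙ y) ⊙ (z ⊙ w)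
  ⊙-interchange x y z w zy≈yz = begin
    (x ⊙ z) ⊙ (y ⊙ w)  ≈⟨ ⊙-assoc x z (y ⊙ w) ⟩
    x ⊙ (z ⊙ (y ⊙ w))  ≈⟨ ⊙-cong (≈-refl {x}) (≈-sym (⊙-assoc z y w)) ⟩
    x ⊙ ((z ⊙ y) ⊙ w)  ≈⟨ ⊙-cong (≈-refl {x}) (⊙-cong zy≈yz (≈-refl {w})) ⟩
    x ⊙ ((y ⊙ z) ⊙ w)  ≈⟨ ⊙-cong (≈-refl {x}) (⊙-assoc y z w) ⟩
    x ⊙ (y ⊙ (z ⊙ w))  ≈⟨ ≈-sym (⊙-assoc x y (z ⊙ w)) ⟩
    (x ⊙ y) ⊙ (z ⊙ w)  ∎

  pow-identity : ∀ n → pow ∅ n ≈ ∅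
  pow-identity zero    = ≈-refl
  pow-identity (suc n) = ≈-trans (⊙-identityʳ (pow ∅ n)) (pow-identity n)

  pow-+ : ∀ σ m n → pow σ (m + n) ≈ pow σ m ⊙ pow σ n
  pow-+ σ m zero rewrite +-identityʳ m = ≈-sym (⊙-identityʳ (pow σ m))
  pow-+ σ m (suc n) rewrite +-suc m n = begin
    pow σ (m + n) ⊙ σ        ≈⟨ ⊙-cong (pow-+ σ m n) (≈-refl {σ}) ⟩
    (pow σ m ⊙ pow σ n) ⊙ σ  ≈⟨ ⊙-assoc (pow σ m) (pow σ n) σ ⟩
    pow σ m ⊙ pow σ (suc n)  ∎

  pow-* : ∀ σ m n → pow σ (m * n) ≈ pow (pow σ n) m
  pow-* σ zero    n = ≈-refl
  pow-* σ (suc m) n rewrite +-comm n (m * n) = begin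
    pow σ (m * n + n)        ≈⟨ pow-+ σ (m * n) n ⟩
    pow σ (m * n) ⊙ pow σ n  ≈⟨ ⊙-cong (pow-* σ m n) (≈-refl {pow σ n}) ⟩
    pow (pow σ n) (suc m)    ∎

  pow-comm : ∀ σ τ → σ ⊙ τ ≈ τ ⊙ σ → ∀ n → pow σ n ⊙ τ ≈ τ ⊙ pow σ n
  pow-comm σ τ στ≈τσ zero    = ≈-trans (⊙-identityˡ τ) (≈-sym (⊙-identityʳ τ))
  pow-comm σ τ στ≈τσ (suc n) = begin
    (pow σ n ⊙ σ) ⊙ τ  ≈⟨ ⊙-assoc (pow σ n) σ τ ⟩
    pow σ n ⊙ (σ ⊙ τ)  ≈⟨ ⊙-cong (≈-refl {pow σ n}) στ≈τσ ⟩
    pow σ n ⊙ (τ ⊙ σ)  ≈⟨ ≈-sym (⊙-assoc (pow σ n) τ σ) ⟩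
    (pow σ n ⊙ τ) ⊙ σ  ≈⟨ ⊙-cong (pow-comm σ τ στ≈τσ n) (≈-refl {σ}) ⟩
    (τ ⊙ pow σ n) ⊙ σ  ≈⟨ ⊙-assoc τ (pow σ n) σ ⟩
    τ ⊙ pow σ (suc n)  ∎

  pow-⊙ : ∀ σ τ → σ ⊙ τ ≈ τ ⊙ σ → ∀ n → pow (σ ⊙ τ) n ≈ pow σ n ⊙ pow τ n
  pow-⊙ σ τ στ≈τσ zero    = mk≈ λ _ → refl
  pow-⊙ σ τ στ≈τσ (suc n) = begin
    pow (σ ⊙ τ) n ⊙ (σ ⊙ τ)        ≈⟨ ⊙-cong (pow-⊙ σ τ στ≈τσ n) (≈-refl {σ ⊙ τ}) ⟩
    (pow σ n ⊙ pow τ n) ⊙ (σ ⊙ τ)  ≈⟨ ⊙-interchange (pow σ n) σ (pow τ n) τ (pow-comm τ σ (≈-sym στ≈τσ) n) ⟩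
    pow σ (suc n) ⊙ pow τ (suc n)  ∎

  patInst-⊙ : ∀ σ μ σ′ μ′ → Commutes σ σ′ → Commutes σ μ′ → ∀ n →
              patInst (σ′ ⊙ σ , μ′ ⊙ μ) n ≈ patInst (σ′ , μ′) n ⊙ patInst (σ , μ) n
  patInst-⊙ σ μ σ′ μ′ σσ′ σμ′ n = begin
    pow (σ′ ⊙ σ) n ⊙ (μ′ ⊙ μ)         ≈⟨ ⊙-cong (pow-⊙ σ′ σ (≈-sym (mk≈ σσ′)) n) (≈-refl {μ′ ⊙ μ}) ⟩
    (pow σ′ n ⊙ pow σ n) ⊙ (μ′ ⊙ μ)   ≈⟨ ⊙-interchange (pow σ′ n) μ′ (pow σ n) μ (pow-comm σ μ′ (mk≈ σμ′) n) ⟩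
    (pow σ′ n ⊙ μ′) ⊙ (pow σ n ⊙ μ)   ∎

  patInst-loop : ∀ σ μ σ′ μ′ → Commutes σ′ σ → Commutes σ′ μ → ∀ a b m →
                 pow σ a ⊙ patInst (pow σ b ⊙ σ′ , μ ⊙ μ′) m ≈ patInst (σ , μ) (a + m * b) ⊙ patInst (σ′ , μ′) m
  patInst-loop σ μ σ′ μ′ σ′σ σ′μ a b m = begin
    σᵃ ⊙ (pow (pow σ b ⊙ σ′) m ⊙ (μ ⊙ μ′))   ≈⟨ ⊙-cong (≈-refl {σᵃ}) (⊙-cong powers (≈-refl {μ ⊙ μ′})) ⟩
    σᵃ ⊙ ((σᵐᵇ ⊙ σ′ᵐ) ⊙ (μ ⊙ μ′))            ≈⟨ ⊙-cong (≈-refl {σᵃ}) (⊙-interchange σᵐᵇ μ σ′ᵐ μ′ σ′ᵐμ≈μσ′ᵐ) ⟩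
    σᵃ ⊙ ((σᵐᵇ ⊙ μ) ⊙ (σ′ᵐ ⊙ μ′))            ≈⟨ ≈-sym (⊙-assoc σᵃ (σᵐᵇ ⊙ μ) (σ′ᵐ ⊙ μ′)) ⟩
    (σᵃ ⊙ (σᵐᵇ ⊙ μ)) ⊙ (σ′ᵐ ⊙ μ′)            ≈⟨ ⊙-cong (≈-sym (⊙-assoc σᵃ σᵐᵇ μ)) (≈-refl {σ′ᵐ ⊙ μ′}) ⟩
    ((σᵃ ⊙ σᵐᵇ) ⊙ μ) ⊙ (σ′ᵐ ⊙ μ′)            ≈⟨ ⊙-cong (⊙-cong (≈-sym (pow-+ σ a (m * b))) (≈-refl {μ}))
                                                   (≈-refl {σ′ᵐ ⊙ μ′}) ⟩
    (pow σ (a + m * b) ⊙ μ) ⊙ (σ′ᵐ ⊙ μ′)     ∎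
    where
    σᵃ = pow σ a
    σᵐᵇ = pow σ (m * b)
    σ′ᵐ = pow σ′ m
    σ′ᵐμ≈μσ′ᵐ : σ′ᵐ ⊙ μ ≈ μ ⊙ σ′ᵐ
    σ′ᵐμ≈μσ′ᵐ = pow-comm σ′ μ (mk≈ σ′μ) m
    powers : pow (pow σ b ⊙ σ′) m ≈ σᵐᵇ ⊙ σ′ᵐ
    powers = ≈-trans (pow-⊙ (pow σ b) σ′ (pow-comm σ σ′ (≈-sym (mk≈ σ′σ)) b) m)
                     (⊙-cong (≈-sym (pow-* σ m b)) (≈-refl {σ′ᵐ}))

  instP-hat : ∀ s n → instP (hat s) n ≡ s
  instP-hat ε      n = refl
  instP-hat (tm t) n =
    cong tm (trans ([]-cong t (≈-trans (⊙-identityʳ (pow ∅ n)) (pow-identity n))) ([]-identity t))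

module Unification (Sg : Signature) where
  open Signature Sg
  open Theory Sg
  open Substitutions Sg

  Equations : Set
  Equations = List (Term × Term)

  Solves : Subst → Equations → Set
  Solves η = All (λ (s , t) → s [ η ] ≡ t [ η ])

  Mgu : Equations → Set
  Mgu E = Σ Subst λ γ → Solves γ E × (∀ η → Solves η E → ∃ λ δ → η ≈ γ ⊙ δ)

  _[_]ₑ : Equations → Subst → Equations
  E [ σ ]ₑ = map (λ (s , t) → s [ σ ] , t [ σ ]) E

  []-absorb : ∀ s σ η → η ≈ σ ⊙ η → s [ σ ] [ η ] ≡ s [ η ]
  []-absorb s σ η η≈ση = trans ([]-⊙ s σ η) (sym ([]-cong s η≈ση))

  solves-[]ₑ : ∀ σ η E → η ≈ σ ⊙ η → Solves η E → Solves η (E [ σ ]ₑ)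
  solves-[]ₑ σ η []            η≈ση []         = []
  solves-[]ₑ σ η ((s , t) ∷ E) η≈ση (eq ∷ sol) =
    trans ([]-absorb s σ η η≈ση) (trans eq (sym ([]-absorb t σ η η≈ση))) ∷ solves-[]ₑ σ η E η≈ση sol

  solves-⊙ : ∀ σ γ E → Solves γ (E [ σ ]ₑ) → Solves (σ ⊙ γ) E
  solves-⊙ σ γ []            []         = []
  solves-⊙ σ γ ((s , t) ∷ E) (eq ∷ sol) =
    trans (sym ([]-⊙ s σ γ)) (trans eq ([]-⊙ t σ γ)) ∷ solves-⊙ σ γ E sol

  bind : ℕ → Term → ℕ → Term
  bind x t y with y ≟ x
  ... | yes _ = t
  ... | no _  = var y

  bind-self : ∀ x t → bind x t x ≡ t
  bind-self x t with x ≟ x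
  ... | yes _  = refl
  ... | no x≢x = ⊥-elim (x≢x refl)

  bind-other : ∀ x t {y} → y ≢ x → bind x t y ≡ var y
  bind-other x t {y} y≢x with y ≟ x
  ... | yes y≡x = ⊥-elim (y≢x y≡x)
  ... | no _    = refl

  _≔_ : ℕ → Term → Subst
  x ≔ t = record { app = bind x t ; fin = suc x , λ y x<y → bind-other x t (λ y≡x → <-irrefl (sym y≡x) x<y) }

  ≔-fresh : ∀ x t u → x ∉ vars u → u [ x ≔ t ] ≡ u
  ≔-fresh x t u x∉u =
    trans (⟦⟧-local u (λ y y∈u → bind-other x t (λ { refl → x∉u y∈u }))) (⟦var⟧ u)

  ≔-absorb : ∀ {x t η} → app η x ≡ t [ η ] → η ≈ (x ≔ t) ⊙ η
  ≔-absorb {x} {t} {η} ηx≡tη = mk≈ absorb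
    where
    absorb : ∀ y → app η y ≡ app (x ≔ t) y [ η ]
    absorb y with y ≟ x
    ... | yes refl = ηx≡tη
    ... | no _     = refl

  mgu-delete : ∀ x E → Mgu E → Mgu ((var x , var x) ∷ E)
  mgu-delete x E (γ , sol , general) = γ , refl ∷ sol , λ { η (_ ∷ solη) → general η solη }

  mgu-swap : ∀ s t E → Mgu ((s , t) ∷ E) → Mgu ((t , s) ∷ E)
  mgu-swap s t E (γ , eq ∷ sol , general) =
    γ , sym eq ∷ sol , λ { η (eqη ∷ solη) → general η (sym eqη ∷ solη) }

  mgu-eliminate : ∀ x t E → x ∉ vars t → Mgu (E [ x ≔ t ]ₑ) → Mgu ((var x , t) ∷ E)
  mgu-eliminate x t E x∉t (γ , sol , general) = (x ≔ t) ⊙ γ , solves-x ∷ solves-⊙ (x ≔ t) γ E sol , general′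
    where
    solves-x : app (x ≔ t) x [ γ ] ≡ t [ (x ≔ t) ⊙ γ ]
    solves-x = trans (cong (_[ γ ]) (trans (bind-self x t) (sym (≔-fresh x t t x∉t)))) ([]-⊙ t (x ≔ t) γ)
    general′ : ∀ η → Solves η ((var x , t) ∷ E) → ∃ λ δ → η ≈ ((x ≔ t) ⊙ γ) ⊙ δ
    general′ η (eqη ∷ solη) =
      let η≈ = ≔-absorb eqη
          δ , η≈γδ = general η (solves-[]ₑ (x ≔ t) η E η≈ solη)
      in δ , ≈-trans η≈ (≈-trans (⊙-cong (≈-refl {x ≔ t}) η≈γδ) (≈-sym (⊙-assoc (x ≔ t) γ δ)))

  zipEq : ∀ {n} → Vec Term n → Vec Term n → Equations
  zipEq []       []       = []
  zipEq (s ∷ ss) (t ∷ ts) = (s , t) ∷ zipEq ss ts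

  solves-zipEq⁺ : ∀ {n} η (ss ts : Vec Term n) E →
                  ss ⟦ app η ⟧V ≡ ts ⟦ app η ⟧V → Solves η E → Solves η (zipEq ss ts ++ E)
  solves-zipEq⁺ η []       []       E eq sol = sol
  solves-zipEq⁺ η (s ∷ ss) (t ∷ ts) E eq sol =
    Vec.∷-injectiveˡ eq ∷ solves-zipEq⁺ η ss ts E (Vec.∷-injectiveʳ eq) sol

  solves-zipEq⁻ : ∀ {n} η (ss ts : Vec Term n) E →
                  Solves η (zipEq ss ts ++ E) → ss ⟦ app η ⟧V ≡ ts ⟦ app η ⟧V × Solves η E
  solves-zipEq⁻ η []       []       E sol         = refl , sol
  solves-zipEq⁻ η (s ∷ ss) (t ∷ ts) E (eq ∷ sol) =
    let eqs , solE = solves-zipEq⁻ η ss ts E sol in cong₂ _∷_ eq eqs , solE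

  fn-injectiveˡ : ∀ {f g} {ss : Vec Term (arity f)} {ts : Vec Term (arity g)} → fn f ss ≡ fn g ts → f ≡ g
  fn-injectiveˡ refl = refl

  fn-injectiveʳ : ∀ {f} {ss ts : Vec Term (arity f)} → fn f ss ≡ fn f ts → ss ≡ ts
  fn-injectiveʳ refl = refl

  mgu-decompose : ∀ f (ss ts : Vec Term (arity f)) E → Mgu (zipEq ss ts ++ E) → Mgu ((fn f ss , fn f ts) ∷ E)
  mgu-decompose f ss ts E (γ , sol , general) =
    let eqs , solE = solves-zipEq⁻ γ ss ts E sol
    in γ , cong (fn f) eqs ∷ solE ,
       λ { η (eqη ∷ solη) → general η (solves-zipEq⁺ η ss ts E (fn-injectiveʳ eqη) solη) }

  occurs-check : ∀ η {x f} (ts : Vec Term (arity f)) → x ∈ varsV ts → app η x ≢ fn f ts [ η ]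
  occurs-check η ts x∈ eq = <-irrefl (cong size eq) (s≤s (sizeV-⟦⟧ ts (app η) x∈))

  sizeₑ : Equations → ℕ
  sizeₑ []            = 0
  sizeₑ ((s , t) ∷ E) = size s + size t + sizeₑ E

  sizeₑ-zipEq : ∀ {n} (ss ts : Vec Term n) E → sizeₑ (zipEq ss ts ++ E) ≡ sizeV ss + sizeV ts + sizeₑ E
  sizeₑ-zipEq []       []       E = refl
  sizeₑ-zipEq (s ∷ ss) (t ∷ ts) E =
    trans (cong (size s + size t +_) (sizeₑ-zipEq ss ts E))
          (rearrange (size s) (sizeV ss) (size t) (sizeV ts) (sizeₑ E))
    where
    rearrange : ∀ a as b bs e → a + b + (as + bs + e) ≡ a + as + (b + bs) + e
    rearrange = solve-∀

  sizeₑ-delete : ∀ x E → sizeₑ E < sizeₑ ((var x , var x) ∷ E)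
  sizeₑ-delete x E = m<n⇒m<1+n (n<1+n (sizeₑ E))

  sizeₑ-decompose : ∀ f (ss ts : Vec Term (arity f)) E →
                    sizeₑ (zipEq ss ts ++ E) < sizeₑ ((fn f ss , fn f ts) ∷ E)
  sizeₑ-decompose f ss ts E rewrite sizeₑ-zipEq ss ts E =
    +-monoˡ-< (sizeₑ E) (+-mono-< (n<1+n (sizeV ss)) (n<1+n (sizeV ts)))

  Covers : List ℕ → Equations → Set
  Covers L = All (λ (s , t) → vars s ⊆ L × vars t ⊆ L)

  covers-zipEq : ∀ {n L} (ss ts : Vec Term n) E →
                 varsV ss ⊆ L → varsV ts ⊆ L → Covers L E → Covers L (zipEq ss ts ++ E)
  covers-zipEq []       []       E ss⊆ ts⊆ cov = cov
  covers-zipEq (s ∷ ss) (t ∷ ts) E ss⊆ ts⊆ cov =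
    (ss⊆ ∘ ∈-++⁺ˡ , ts⊆ ∘ ∈-++⁺ˡ) ∷ covers-zipEq ss ts E (ss⊆ ∘ ∈-++⁺ʳ (vars s)) (ts⊆ ∘ ∈-++⁺ʳ (vars t)) cov

  _∖_ : List ℕ → ℕ → List ℕ
  L ∖ x = filter (λ y → ¬? (y ≟ x)) L

  ∖-shorter : ∀ {x L} → x ∈ L → length (L ∖ x) < length L
  ∖-shorter x∈L = filter-notAll _ _ (Any.map (λ { refl x≢x → x≢x refl }) x∈L)

  vars-≔ : ∀ {x t L} u → x ∉ vars t → vars t ⊆ L → vars u ⊆ L → vars (u [ x ≔ t ]) ⊆ L ∖ x
  vars-≔ {x} {t} u x∉t t⊆L u⊆L z∈ with vars-⟦⟧ u (app (x ≔ t)) z∈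
  ... | y , y∈u , z∈y with y ≟ x
  ...   | yes refl = ∈-filter⁺ _ (t⊆L z∈y) (λ { refl → x∉t z∈y })
  vars-≔ u x∉t t⊆L u⊆L z∈ | y , y∈u , here refl | no y≢x = ∈-filter⁺ _ (u⊆L y∈u) y≢x

  covers-≔ : ∀ {x t L} E → x ∉ vars t → vars t ⊆ L → Covers L E → Covers (L ∖ x) (E [ x ≔ t ]ₑ)
  covers-≔ []            x∉t t⊆L []                 = []
  covers-≔ ((s , u) ∷ E) x∉t t⊆L ((s⊆ , u⊆) ∷ cov) =
    (vars-≔ s x∉t t⊆L s⊆ , vars-≔ u x∉t t⊆L u⊆) ∷ covers-≔ E x∉t t⊆L cov

  -- Martelli–Montanari unification, run under the hypothesis that η solves the system, which refutes
  -- the failing branches (symbol clash, occurs check).  Termination is lexicographic in the length of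
  -- a variable list L covering the system and the size of the system.
  module _ (η : Subst) where
    mutual
      unify : ∀ E L → Acc _<_ (length L) → Acc _<_ (sizeₑ E) → Covers L E → Solves η E → Mgu E
      unify [] L _ _ _ _ = ∅ , [] , λ η′ _ → η′ , mk≈ λ _ → refl
      unify ((var x , var y) ∷ E) L accL (acc smaller) ((x⊆ , y⊆) ∷ cov) (eq ∷ sol) with x ≟ y
      ... | yes refl = mgu-delete x E (unify E L accL (smaller (sizeₑ-delete x E)) cov sol)
      ... | no x≢y   = eliminate x (var y) E L accL (λ { (here x≡y) → x≢y x≡y }) (x⊆ (here refl)) y⊆ cov eq sol
      unify ((var x , fn g ts) ∷ E) L accL _ ((x⊆ , ts⊆) ∷ cov) (eq ∷ sol) with x ∈? varsV ts
      ... | yes x∈ts = ⊥-elim (occurs-check η ts x∈ts eq)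
      ... | no x∉ts  = eliminate x (fn g ts) E L accL x∉ts (x⊆ (here refl)) ts⊆ cov eq sol
      unify ((fn f ss , var y) ∷ E) L accL _ ((ss⊆ , y⊆) ∷ cov) (eq ∷ sol) with y ∈? varsV ss
      ... | yes y∈ss = ⊥-elim (occurs-check η ss y∈ss (sym eq))
      ... | no y∉ss  =
        mgu-swap (var y) (fn f ss) E (eliminate y (fn f ss) E L accL y∉ss (y⊆ (here refl)) ss⊆ cov (sym eq) sol)
      unify ((fn f ss , fn g ts) ∷ E) L accL (acc smaller) ((ss⊆ , ts⊆) ∷ cov) (eq ∷ sol) with fn-injectiveˡ eq
      ... | refl = mgu-decompose f ss ts E
        (unify (zipEq ss ts ++ E) L accL (smaller (sizeₑ-decompose f ss ts E))
               (covers-zipEq ss ts E ss⊆ ts⊆ cov) (solves-zipEq⁺ η ss ts E (fn-injectiveʳ eq) sol))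

      eliminate : ∀ x t E L → Acc _<_ (length L) → x ∉ vars t → x ∈ L → vars t ⊆ L → Covers L E →
                  app η x ≡ t [ η ] → Solves η E → Mgu ((var x , t) ∷ E)
      eliminate x t E L (acc shorter) x∉t x∈L t⊆L cov eq sol =
        mgu-eliminate x t E x∉t
          (unify (E [ x ≔ t ]ₑ) (L ∖ x) (shorter (∖-shorter x∈L)) (<-wellFounded _)
                 (covers-≔ E x∉t t⊆L cov) (solves-[]ₑ (x ≔ t) η E (≔-absorb eq) sol))

  mgu-exists : ∀ s t η → s [ η ] ≡ t [ η ] → Σ Subst λ γ → MGU γ ⟨ tm s ⟩ ⟨ tm t ⟩
  mgu-exists s t η eq with unify η ((s , t) ∷ []) (vars s ++ vars t) (<-wellFounded _) (<-wellFounded _)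
                                 ((∈-++⁺ˡ , ∈-++⁺ʳ (vars s)) ∷ []) (eq ∷ [])
  ... | γ , eqγ ∷ [] , general = γ , cong (λ u → ⟨ tm u ⟩) eqγ , general′
    where
    general′ : ∀ η′ → Unifies η′ ⟨ tm s ⟩ ⟨ tm t ⟩ → ∃ λ δ → ∀ x → app η′ x ≡ app (γ ⊙ δ) x
    general′ η′ eqη′ = let δ , η′≈γδ = general η′ (tm-injective (List.∷-injectiveˡ eqη′) ∷ []) in δ , app-≈ η′≈γδ

module RenamingApart (Sg : Signature) where
  open Theory Sg
  open Substitutions Sg

  swap : ℕ → ℕ → ℕ
  swap N y = if does (y <? N) then y + N else if does (y <? N + N) then y ∸ N else y

  swap-< : ∀ N {y} → y < N → swap N y ≡ y + N
  swap-< N {y} y<N rewrite dec-true (y <? N) y<N = refl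

  swap-middle : ∀ N {y} → N ≤ y → y < N + N → swap N y ≡ y ∸ N
  swap-middle N {y} N≤y y<2N rewrite dec-false (y <? N) (≤⇒≯ N≤y) | dec-true (y <? N + N) y<2N = refl

  swap-≥ : ∀ N {y} → ¬ y < N + N → swap N y ≡ y
  swap-≥ N {y} y≮2N
    rewrite dec-false (y <? N) (λ y<N → y≮2N (≤-trans y<N (m≤m+n N N))) | dec-false (y <? N + N) y≮2N = refl

  swap-involutive : ∀ N y → swap N (swap N y) ≡ y
  swap-involutive N y with y <? N | y <? N + N
  ... | yes y<N | _ =
    trans (cong (swap N) (swap-< N y<N))
          (trans (swap-middle N (m≤n+m N y) (+-monoˡ-< N y<N)) (m+n∸n≡m y N))
  ... | no y≮N  | yes y<2N =
    trans (cong (swap N) (swap-middle N (≮⇒≥ y≮N) y<2N))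
          (trans (swap-< N (subst (y ∸ N <_) (m+n∸n≡m N N) (∸-monoˡ-< y<2N (≮⇒≥ y≮N)))) (m∸n+n≡m (≮⇒≥ y≮N)))
  ... | no _    | no y≮2N = trans (cong (swap N) (swap-≥ N y≮2N)) (swap-≥ N y≮2N)

  shift : ℕ → Subst
  shift N = record { app = var ∘ swap N ; fin = N + N , λ y 2N≤y → cong var (swap-≥ N (λ y<2N → <⇒≱ y<2N 2N≤y)) }

  shift-renaming : ∀ N → IsRenaming (shift N)
  shift-renaming N =
    swap N , (λ _ → refl) ,
    (λ x y eq → trans (sym (swap-involutive N x)) (trans (cong (swap N) eq) (swap-involutive N y))) ,
    (λ y → swap N y , swap-involutive N y)

  joinᶠ : ℕ → Subst → Subst → ℕ → Term
  joinᶠ N κ ξ y = if does (y <? N) then app κ y else app ξ (swap N y)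

  joinᶠ-< : ∀ N κ ξ {y} → y < N → joinᶠ N κ ξ y ≡ app κ y
  joinᶠ-< N κ ξ {y} y<N = cong (λ b → if b then app κ y else app ξ (swap N y)) (dec-true (y <? N) y<N)

  joinᶠ-≮ : ∀ N κ ξ {y} → ¬ y < N → joinᶠ N κ ξ y ≡ app ξ (swap N y)
  joinᶠ-≮ N κ ξ {y} y≮N = cong (λ b → if b then app κ y else app ξ (swap N y)) (dec-false (y <? N) y≮N)

  join : ℕ → Subst → Subst → Subst
  join N κ ξ = record { app = joinᶠ N κ ξ ; fin = N + N ⊔ proj₁ (fin ξ) , beyond }
    where
    beyond : ∀ y → N + N ⊔ proj₁ (fin ξ) ≤ y → joinᶠ N κ ξ y ≡ var y
    beyond y bound =
      trans (joinᶠ-≮ N κ ξ (λ y<N → <⇒≱ y<N (≤-trans (≤-trans (m≤m+n N N) (m≤m⊔n _ _)) bound)))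
            (trans (cong (app ξ) (swap-≥ N (λ y<2N → <⇒≱ y<2N (≤-trans (m≤m⊔n _ _) bound))))
                   (proj₂ (fin ξ) y (≤-trans (m≤n⊔m _ _) bound)))

  join-swap : ∀ N κ ξ {y} → y < N → app (join N κ ξ) (swap N y) ≡ app ξ y
  join-swap N κ ξ {y} y<N =
    trans (joinᶠ-≮ N κ ξ (subst (λ z → ¬ z < N) (sym (swap-< N y<N)) (λ y+N<N → <⇒≱ y+N<N (m≤n+m N y))))
          (cong (app ξ) (swap-involutive N y))

  Below : ℕ → Term → Set
  Below N t = All (_< N) (vars t)

  join-below : ∀ N κ ξ t → Below N t → t [ join N κ ξ ] ≡ t [ κ ]
  join-below N κ ξ t below = ⟦⟧-local t (λ y y∈t → joinᶠ-< N κ ξ (All.lookup below y∈t))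

  shift-join : ∀ N κ ξ t → Below N t → t [ shift N ⊙ join N κ ξ ] ≡ t [ ξ ]
  shift-join N κ ξ t below = ⟦⟧-local t (λ y y∈t → join-swap N κ ξ (All.lookup below y∈t))

  shift-above : ∀ N t {x} → Below N t → x ∈ vars (t [ shift N ]) → N ≤ x
  shift-above N t below x∈ with vars-⟦⟧ t (app (shift N)) x∈
  ... | y , y∈t , here refl = subst (N ≤_) (sym (swap-< N (All.lookup below y∈t))) (m≤n+m N y)

  varL-below : ∀ {N x} ts → All (Below N) ts → VarL ts x → x < N
  varL-below (t ∷ ts) (below ∷ _)  (inj₁ x∈t)  = All.lookup below x∈t
  varL-below (t ∷ ts) (_ ∷ belows) (inj₂ x∈ts) = varL-below ts belows x∈ts

  varL-shift-above : ∀ {N x} ts → All (Below N) ts → VarL (map (_[ shift N ]) ts) x → N ≤ x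
  varL-shift-above (t ∷ ts) (below ∷ _)  (inj₁ x∈t)  = shift-above _ t below x∈t
  varL-shift-above (t ∷ ts) (_ ∷ belows) (inj₂ x∈ts) = varL-shift-above ts belows x∈ts

  bound : List Term → ℕ
  bound ts = suc (max 0 (concatMap vars ts))

  below-bound : ∀ ts → All (Below (bound ts)) ts
  below-bound ts = All.map⁻ (All.map (All.map s≤s) (All.concat⁻ (xs≤max 0 (concatMap vars ts))))

module Resolution (Sg : Signature) (P : Theory.Program Sg) where
  open Theory Sg
  open Substitutions Sg
  open Unification Sg using (mgu-exists)
  open RenamingApart Sg

  -- A resolution step with an arbitrary instance of a clause: no renaming apart, no mgu.
  data _⟶_ : List Term → List Term → Set where
    resolve : ∀ {h vs} → P (h , vs) → ∀ ξ s̄ → (h [ ξ ] ∷ s̄) ⟶ (map (_[ ξ ]) vs ++ s̄)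

  lift-step : ∀ {G Ĝ Ĝ′} κ → map (_[ κ ]) G ≡ Ĝ → Ĝ ⟶ Ĝ′ →
              ∃ λ G′ → StepP P G G′ × ∃ λ κ′ → map (_[ κ′ ]) G′ ≡ Ĝ′
  lift-step {[]}    κ () (resolve _ _ _)
  lift-step {g ∷ ḡ} κ Gκ≡ (resolve {h} {vs} h←vs ξ s̄) =
    G′ ,
    ((h , vs) , h←vs , g , ḡ , refl , h [ ρ ] , map (_[ ρ ]) vs , (ρ , shift-renaming N , refl) ,
     apart , γ , γ-mgu , refl) ,
    δ , G′δ≡
    where
    N = bound (h ∷ vs ++ g ∷ ḡ)
    ρ = shift N
    η = join N κ ξ
    hvs-below : All (Below N) (h ∷ vs)
    hvs-below = All.++⁻ˡ (h ∷ vs) (below-bound (h ∷ vs ++ g ∷ ḡ))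
    G-below : All (Below N) (g ∷ ḡ)
    G-below = All.++⁻ʳ (h ∷ vs) (below-bound (h ∷ vs ++ g ∷ ḡ))
    h-below = All.head hvs-below
    vs-below = All.tail hvs-below

    η-unifies : h [ ρ ] [ η ] ≡ g [ η ]
    η-unifies = begin
      h [ ρ ] [ η ]  ≡⟨ []-⊙ h ρ η ⟩
      h [ ρ ⊙ η ]    ≡⟨ shift-join N κ ξ h h-below ⟩
      h [ ξ ]        ≡⟨ sym (List.∷-injectiveˡ Gκ≡) ⟩
      g [ κ ]        ≡⟨ sym (join-below N κ ξ g (All.head G-below)) ⟩
      g [ η ]        ∎
      where open ≡-Reasoning

    γ-and-mgu = mgu-exists (h [ ρ ]) g η η-unifies
    γ = proj₁ γ-and-mgu
    γ-mgu = proj₂ γ-and-mgu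
    δ = proj₁ (proj₂ γ-mgu η (cong (λ t → ⟨ tm t ⟩) η-unifies))
    η≈γδ : η ≈ γ ⊙ δ
    η≈γδ = mk≈ (proj₂ (proj₂ γ-mgu η (cong (λ t → ⟨ tm t ⟩) η-unifies)))

    apart : Disjoint (VarR (h [ ρ ] , map (_[ ρ ]) vs)) (VarL (g ∷ ḡ))
    apart x (inj₁ x∈h) x∈G = <⇒≱ (varL-below (g ∷ ḡ) G-below x∈G) (shift-above N h h-below x∈h)
    apart x (inj₂ x∈vs) x∈G = <⇒≱ (varL-below (g ∷ ḡ) G-below x∈G) (varL-shift-above vs vs-below x∈vs)

    G′ = map (_[ γ ]) (map (_[ ρ ]) vs ++ ḡ)
    G′δ≡ : map (_[ δ ]) G′ ≡ map (_[ ξ ]) vs ++ s̄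
    G′δ≡ = begin
      map (_[ δ ]) G′                                    ≡⟨ map-[]-⊙ γ δ _ ⟩
      map (_[ γ ⊙ δ ]) (map (_[ ρ ]) vs ++ ḡ)            ≡⟨ map-[]-cong (≈-sym η≈γδ) _ ⟩
      map (_[ η ]) (map (_[ ρ ]) vs ++ ḡ)                ≡⟨ List.map-++ (_[ η ]) (map (_[ ρ ]) vs) ḡ ⟩
      map (_[ η ]) (map (_[ ρ ]) vs) ++ map (_[ η ]) ḡ   ≡⟨ cong₂ _++_ renamed-body rest ⟩
      map (_[ ξ ]) vs ++ map (_[ κ ]) ḡ                  ≡⟨ cong (map (_[ ξ ]) vs ++_) (List.∷-injectiveʳ Gκ≡) ⟩
      map (_[ ξ ]) vs ++ s̄                               ∎
      where
      open ≡-Reasoning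
      renamed-body = trans (map-[]-⊙ ρ η vs) (List.map-cong-local (All.map (λ {t} → shift-join N κ ξ t) vs-below))
      rest = List.map-cong-local (All.map (λ {t} → join-below N κ ξ t) (All.tail G-below))

  infiniteChain-lift : ∀ {G} → InfiniteChain _⟶_ G → InfiniteChain (StepP P) G
  infiniteChain-lift {G} (ĉ , refl , steps) = infiniteChain-unfold Lifts next (0 , ∅ , map-[]-identity G)
    where
    Lifts : List Term → Set
    Lifts G = ∃ λ k → ∃ λ κ → map (_[ κ ]) G ≡ ĉ k
    next : ∀ {G} → Lifts G → ∃ λ G′ → StepP P G G′ × Lifts G′
    next (k , κ , Gκ≡) =
      let G′ , step , κ′ , G′κ′≡ = lift-step κ Gκ≡ (steps k) in G′ , step , suc k , κ′ , G′κ′≡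

module Realisation (Sg : Signature) (P : Theory.Program Sg) where
  open Signature Sg
  open Theory Sg
  open Substitutions Sg
  open Resolution Sg P

  _⟶*_ : List Term → List Term → Set
  _⟶*_ = Star _⟶_

  _⟶⁺_ : List Term → List Term → Set
  _⟶⁺_ = Plus _⟶_

  Leads : (List Term → List Term → Set) → List Term → TermE → List Term → Set
  Leads R G ε      s̄ = R G s̄
  Leads R G (tm w) s̄ = ∃ λ t̄ → R G (w ∷ t̄ ++ s̄)

  Realised : (List Term → List Term → Set) → BinRule → Set
  Realised R (ε    , v) = ⊥
  Realised R (tm h , v) = ∀ ξ s̄ → Leads R (h [ ξ ] ∷ s̄) (v [ ξ ]E) s̄

  leads-map : ∀ {R R′ : List Term → List Term → Set} → (∀ {G G′} → R G G′ → R′ G G′) →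
              ∀ {G s̄} v → Leads R G v s̄ → Leads R′ G v s̄
  leads-map R⇒R′ ε      G→s̄        = R⇒R′ G→s̄
  leads-map R⇒R′ (tm w) (t̄ , G→w) = t̄ , R⇒R′ G→w

  realised-map : ∀ {R R′ : List Term → List Term → Set} → (∀ {G G′} → R G G′ → R′ G G′) →
                 ∀ b → Realised R b → Realised R′ b
  realised-map R⇒R′ (tm h , v) realised ξ s̄ = leads-map R⇒R′ (v [ ξ ]E) (realised ξ s̄)

  plus⇒star : ∀ {G G′} → G ⟶⁺ G′ → G ⟶* G′
  plus⇒star (_ , step , steps) = step ◅ steps

  leads-◅◅ : ∀ {G G′ s̄} → G ⟶* G′ → ∀ v → Leads _⟶*_ G′ v s̄ → Leads _⟶*_ G v s̄
  leads-◅◅ G→G′ ε      G′→s̄        = G→G′ ◅◅ G′→s̄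
  leads-◅◅ G→G′ (tm w) (t̄ , G′→w) = t̄ , G→G′ ◅◅ G′→w

  leads-◅ : ∀ {G G′ s̄} → G ⟶ G′ → ∀ v → Leads _⟶*_ G′ v s̄ → Leads _⟶⁺_ G v s̄
  leads-◅ G→G′ ε      G′→s̄        = _ , G→G′ , G′→s̄
  leads-◅ G→G′ (tm w) (t̄ , G′→w) = t̄ , _ , G→G′ , G′→w

  leads-++ : ∀ {R G xs s̄} v → (v ≡ ε → xs ≡ []) → Leads R G v (xs ++ s̄) → Leads R G v s̄
  leads-++ {R} {G} {s̄ = s̄} ε empty G→ = subst (λ ys → R G (ys ++ s̄)) (empty refl) G→
  leads-++ {R} {G} {xs} {s̄} (tm w) _ (t̄ , G→w) =
    t̄ ++ xs , subst (R G ∘ (w ∷_)) (sym (List.++-assoc t̄ xs s̄)) G→w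

  realised-[] : ∀ {R} b ρ → Realised R b → Realised R (proj₁ b [ ρ ]E , proj₂ b [ ρ ]E)
  realised-[] {R} (tm h , v) ρ realised ξ s̄ =
    subst₂ (λ t w → Leads R (t ∷ s̄) w s̄) (sym ([]-⊙ h ρ ξ)) (sym ([]E-⊙ v ρ ξ)) (realised (ρ ⊙ ξ) s̄)

  realised-renClos : ∀ {R S} → (∀ b → S b → Realised R b) → ∀ b → RenClosB S b → Realised R b
  realised-renClos S-realised _ (b , b∈S , ρ , _ , refl) = realised-[] b ρ (S-realised b b∈S)

  diagonal-realised : ∀ h → Realised _⟶*_ (tm h , tm h)
  diagonal-realised h ξ s̄ = [] , ε

  unifies-pointwise : ∀ θ ξ as ws → Unifies θ as (map tm ws) →
                      Pointwise (λ a w → a [ θ ⊙ ξ ]E ≡ tm (w [ θ ⊙ ξ ])) as ws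
  unifies-pointwise θ ξ []       []       _  = []
  unifies-pointwise θ ξ (a ∷ as) (w ∷ ws) eq =
    trans (sym ([]E-⊙ a θ ξ)) (trans (cong (_[ ξ ]E) (List.∷-injectiveˡ eq)) ([]E-⊙ (tm w) θ ξ))
    ∷ unifies-pointwise θ ξ as ws (List.∷-injectiveʳ eq)

  body-leads : ∀ {us ui v ws} ζ s̄ → All (λ u → Realised _⟶*_ (u , ε)) us → Realised _⟶*_ (ui , v) →
               Pointwise (λ a w → a [ ζ ]E ≡ tm (w [ ζ ])) (us ++ ⟨ ui ⟩) ws →
               Leads _⟶*_ (map (_[ ζ ]) ws ++ s̄) (v [ ζ ]E) s̄
  body-leads {[]} {ε} ζ s̄ [] () _
  body-leads {[]} {tm ui} {v} ζ s̄ [] ui-realised (eq ∷ []) =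
    subst (λ t → Leads _⟶*_ (t ∷ s̄) (v [ ζ ]E) s̄) (tm-injective eq) (ui-realised ζ s̄)
  body-leads {ε ∷ us} ζ s̄ (() ∷ _) _ _
  body-leads {tm u ∷ us} {v = v} {w ∷ ws} ζ s̄ (u-realised ∷ us-realised) ui-realised (eq ∷ eqs) =
    leads-◅◅ (subst (λ t → (t ∷ rest) ⟶* rest) (tm-injective eq) (u-realised ζ rest)) (v [ ζ ]E)
             (body-leads ζ s̄ us-realised ui-realised eqs)
    where rest = map (_[ ζ ]) ws ++ s̄

  resolvent-realised : ∀ {h vs us ui v} i θ → P (h , vs) → (i < length vs → v ≢ ε) →
                       All (λ u → Realised _⟶*_ (u , ε)) us → Realised _⟶*_ (ui , v) →
                       Unifies θ (us ++ ⟨ ui ⟩) (map tm (take i vs)) →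
                       Realised _⟶⁺_ (tm (h [ θ ]) , v [ θ ]E)
  resolvent-realised {h} {vs} {us} {ui} {v} i θ h←vs nonfinal us-realised ui-realised unifies ξ s̄ =
    subst₂ (λ t w → Leads _⟶⁺_ (t ∷ s̄) w s̄) (sym ([]-⊙ h θ ξ)) (sym ([]E-⊙ v θ ξ))
      (leads-◅ (resolve h←vs ζ s̄) (v [ ζ ]E)
        (leads-++ (v [ ζ ]E) body-exhausted
          (subst (λ G → Leads _⟶*_ G (v [ ζ ]E) (later ++ s̄)) split
            (body-leads ζ (later ++ s̄) us-realised ui-realised
              (unifies-pointwise θ ξ (us ++ ⟨ ui ⟩) (take i vs) unifies)))))
    where
    ζ = θ ⊙ ξ
    later = map (_[ ζ ]) (drop i vs)
    body-exhausted : v [ ζ ]E ≡ ε → later ≡ []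
    body-exhausted vζ≡ε =
      cong (map (_[ ζ ])) (List.drop-all i vs (≮⇒≥ (λ i<len → nonfinal i<len ([]E-ε v ζ vζ≡ε))))
    split : map (_[ ζ ]) (take i vs) ++ (later ++ s̄) ≡ map (_[ ζ ]) vs ++ s̄
    split = begin
      map (_[ ζ ]) (take i vs) ++ (later ++ s̄)   ≡⟨ List.++-assoc (map (_[ ζ ]) (take i vs)) later s̄ ⟨
      (map (_[ ζ ]) (take i vs) ++ later) ++ s̄   ≡⟨ cong (_++ s̄) (List.map-++ (_[ ζ ]) (take i vs) (drop i vs)) ⟨
      map (_[ ζ ]) (take i vs ++ drop i vs) ++ s̄ ≡⟨ cong (λ ys → map (_[ ζ ]) ys ++ s̄) (List.take++drop≡id i vs) ⟩
      map (_[ ζ ]) vs ++ s̄                       ∎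
      where open ≡-Reasoning

  weakly-realised : ∀ {U} → (∀ b → U b → Realised _⟶⁺_ b) → ∀ b → (U ∪ IdRules) b → Realised _⟶*_ b
  weakly-realised U-realised b (inj₁ b∈U)                = realised-map plus⇒star b (U-realised b b∈U)
  weakly-realised U-realised _ (inj₂ (f , xs , _ , refl)) = diagonal-realised (idTerm f xs)

  facts-realised : ∀ b → FactsB P b → Realised _⟶⁺_ b
  facts-realised _ (u , u← , refl) ξ s̄ = _ , resolve u← ξ s̄ , ε

  genB-realised : ∀ {U} → (∀ b → U b → Realised _⟶⁺_ b) → ∀ b → GenB P U b → Realised _⟶⁺_ b
  genB-realised U-realised _
    (u , vs , u←vs , us , ui , v , _ , (premises , _) , nonfinal , θ , (unifies , _) , refl) =
    resolvent-realised (suc (length us)) θ u←vs nonfinal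
      (All.map (λ {w} → weakly-realised U-realised (w , ε)) (All.map⁻ (All.++⁻ˡ _ premises)))
      (weakly-realised U-realised (ui , v) (All.head (All.++⁻ʳ (map (λ w → w , ε) us) premises)))
      unifies

  binunf-realised : ∀ b → binunf P b → Realised _⟶⁺_ b
  binunf-realised b (k , b∈) = iterβ-realised k b b∈
    where
    iterβ-realised : ∀ k b → iterβ P k b → Realised _⟶⁺_ b
    iterβ-realised (suc k) b (inj₁ b∈) = realised-renClos facts-realised b b∈
    iterβ-realised (suc k) b (inj₂ b∈) = realised-renClos (genB-realised (iterβ-realised k)) b b∈

  instR : PatRule → ℕ → BinRule
  instR (p , q) n = instP p n , instP q n

  weakly-realisedᵖ : ∀ {U} → (∀ r → U r → ∀ n → Realised _⟶⁺_ (instR r n)) →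
                     ∀ r → (U ∪ PatId) r → ∀ n → Realised _⟶*_ (instR r n)
  weakly-realisedᵖ U-realised r (inj₁ r∈U) n = realised-map plus⇒star (instR r n) (U-realised r r∈U n)
  weakly-realisedᵖ U-realised _ (inj₂ (f , xs , _ , refl)) n =
    diagonal-realised (idTerm f xs [ patInst (∅ , ∅) n ])

  genP-realised : ∀ {U} → (∀ r → U r → ∀ n → Realised _⟶⁺_ (instR r n)) →
                  ∀ r → GenP P U r → ∀ n → Realised _⟶⁺_ (instR r n)
  genP-realised U-realised _
    (u , vs , u←vs , ps , p , v , σᵢ , μᵢ , _ , (premises , _) , nonfinal , σ , μ , mgu , σσᵢ , σμᵢ , refl) n =
    subst (λ w → Realised _⟶⁺_ (tm (u [ θ ]) , w)) body-instance
      (resolvent-realised (suc (length ps)) θ u←vs (λ i<len → nonfinal i<len ∘ []E-ε v _)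
        (All.map⁺ (All.map (λ {q} q∈ → weakly-realisedᵖ U-realised (q , hat ε) q∈ n)
                             (All.map⁻ (All.++⁻ˡ _ premises))))
        (weakly-realisedᵖ U-realised _ (All.head (All.++⁻ʳ (map (λ q → q , hat ε) ps) premises)) n)
        (subst₂ (Unifies θ) (List.map-++ (λ q → instP q n) ps ⟨ p ⟩) (instP-hats (take (suc (length ps)) vs))
                (proj₁ (mgu n))))
    where
    θ = patInst (σ , μ) n
    body-instance : v [ patInst (σᵢ , μᵢ) n ]E [ θ ]E ≡ v [ patInst (σᵢ ⊙ σ , μᵢ ⊙ μ) n ]E
    body-instance = trans ([]E-⊙ v _ θ) (sym ([]E-cong v (patInst-⊙ σ μ σᵢ μᵢ σσᵢ σμᵢ n)))
    instP-hats : ∀ ws → map (λ q → instP q n) (map (λ w → hat (tm w)) ws) ≡ map tm ws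
    instP-hats ws = trans (sym (List.map-∘ ws)) (List.map-cong (λ w → instP-hat (tm w) n) ws)

  patunf-realised : ∀ {B} → CorrectSet P B → ∀ r → patunf P B r → ∀ n → Realised _⟶⁺_ (instR r n)
  patunf-realised {B} correct r (k , r∈) = iterπ-realised k r r∈
    where
    iterπ-realised : ∀ k r → iterπ P B k r → ∀ n → Realised _⟶⁺_ (instR r n)
    iterπ-realised (suc k) _ (inj₁ (r , r∈B , renamed)) n =
      realised-renClos (λ b b∈ → binunf-realised b (correct r r∈B b b∈)) _ (renamed _ (n , refl))
    iterπ-realised (suc k) _ (inj₂ (r , r∈ , renamed)) n =
      realised-renClos (λ { _ (m , refl) → genP-realised (iterπ-realised k) r r∈ m }) _ (renamed _ (n , refl))

theorem3p13 : (Sg : Signature) → let open Theory Sg in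
    (P : Program) (B : PatRule → Set) → CorrectSet P B →
    (a b : ℕ) (u : Term) (σ μ σ' μ' : Subst) →
    Commutes σ' σ → Commutes σ' μ →
    patunf P B ((tm u , (σ , μ)) , (tm (u [ pow σ a ]) , (pow σ b ⊙ σ' , μ ⊙ μ'))) →
    (n : ℕ) (θ : Subst) →
    InfiniteChainFrom P ⟨ ((u [ pow σ n ]) [ μ ]) [ θ ] ⟩
theorem3p13 Sg P B correct a b u σ μ σ′ μ′ σ′σ σ′μ loop n θ =
  infiniteChain-lift (infiniteChain-progress Looping progress (n , θ , [] , start))
  where
  open Theory Sg
  open Substitutions Sg
  open Resolution Sg P
  open Realisation Sg P

  Looping : List Term → Set
  Looping G = ∃ λ m → ∃ λ ξ → ∃ λ s̄ → G ≡ u [ patInst (σ , μ) m ] [ ξ ] ∷ s̄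

  start : ⟨ u [ pow σ n ] [ μ ] [ θ ] ⟩ ≡ ⟨ u [ patInst (σ , μ) n ] [ θ ] ⟩
  start = cong (λ t → ⟨ t [ θ ] ⟩) ([]-⊙ u (pow σ n) μ)

  progress : ∀ {G} → Looping G → ∃ λ G′ → G ⟶⁺ G′ × Looping G′
  progress (m , ξ , s̄ , refl) =
    let t̄ , steps = patunf-realised correct _ loop m ξ s̄
    in _ , steps , a + m * b , patInst (σ′ , μ′) m ⊙ ξ , t̄ ++ s̄ , cong (_∷ t̄ ++ s̄) (loop-step m ξ)
    where
    loop-step : ∀ m ξ → u [ pow σ a ] [ patInst (pow σ b ⊙ σ′ , μ ⊙ μ′) m ] [ ξ ]
                        ≡ u [ patInst (σ , μ) (a + m * b) ] [ patInst (σ′ , μ′) m ⊙ ξ ]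
    loop-step m ξ =
      []-regroup u (pow σ a) (patInst (pow σ b ⊙ σ′ , μ ⊙ μ′) m) (patInst (σ , μ) (a + m * b))
                 (patInst (σ′ , μ′) m) ξ (patInst-loop σ μ σ′ μ′ σ′σ σ′μ a b m)
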